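{- (1) The inclusion functor $I:\mathbf{SGraph}\to\mathbf{Graph}$ has a left adjoint $L:\mathbf{Graph}\to\mathbf{SGraph}$. (2) An arrow $(f,g):\mathcal{G}\to\mathcal{H}$ of $\mathbf{SGraph}$ (with $f$ its edge component and $g$ its node component) is a regular monomorphism in $\mathbf{SGraph}$ if and only if $g$ is injective and $(f,g)$ is edge-reflecting, i.e. for all $v_1,v_2\in V_{\mathcal{G}}$, the set $\mathcal{G}(v_1,v_2)$ is non-empty whenever $\mathcal{H}(g(v_1),g(v_2))\neq\emptyset$.
   Context: A directed graph $\mathcal{G}=(E_{\mathcal{G}},V_{\mathcal{G}},s_{\mathcal{G}},t_{\mathcal{G}})$ consists of sets $E_{\mathcal{G}}$ (edges), $V_{\mathcal{G}}$ (nodes) and functions $s_{\mathcal{G}},t_{\mathcal{G}}:E_{\mathcal{G}}\to V_{\mathcal{G}}$; $\mathcal{G}(v,w)=\{e\mid s_{\mathcal{G}}(e)=v,t_{\mathcal{G}}(e)=w\}$. A morphism $\mathcal{G}\to\mathcal{H}$ is a pair $(f,g)$, $f:E_{\mathcal{G}}\to E_{\mathcal{H}}$, $g:V_{\mathcal{G}}\to V_{\mathcal{H}}$, with $s_{\mathcal{H}}\circ f=g\circ s_{\mathcal{G}}$ and $t_{\mathcal{H}}\circ f=g\circ t_{\mathcal{G}}$; this forms $\mathbf{Graph}$. A graph is simple if $\mathcal{G}(v,w)$ has at most one element for all $v,w$; $\mathbf{SGraph}$ is the full subcategory of simple graphs. -}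

module Defs where

open import Level using (0ℓ)
open import Data.Product using (Σ; Σ-syntax; _×_; _,_; proj₁)
open import Relation.Binary.Bundles using (Setoid)
open import Function.Bundles using (Func)
open import Function.Definitions using (Injective)
open import Function.Base using (id)

-- Sets are modelled as setoids (Bishop sets), so that quotients are available.
-- Directed graph G = (E, V, s, t).
record Graph : Set₁ where
  field
    E : Setoid 0ℓ 0ℓ
    V : Setoid 0ℓ 0ℓ
    s : Func E V
    t : Func E V
  Edge : Set
  Edge = Setoid.Carrier E
  Node : Set
  Node = Setoid.Carrier V
  infix 4 _≈ₑ_ _≈ᵥ_
  _≈ₑ_ : Edge → Edge → Set
  _≈ₑ_ = Setoid._≈_ E
  _≈ᵥ_ : Node → Node → Set
  _≈ᵥ_ = Setoid._≈_ V
  src : Edge → Node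
  src = Func.to s
  tgt : Edge → Node
  tgt = Func.to t
  Hom : Node → Node → Set
  Hom v w = Σ[ e ∈ Edge ] (src e ≈ᵥ v × tgt e ≈ᵥ w)

open Graph

IsSimple : Graph → Set
IsSimple G = ∀ v w (x y : Hom G v w) → _≈ₑ_ G (proj₁ x) (proj₁ y)

record Mor (G H : Graph) : Set where
  field
    f : Func (E G) (E H)
    g : Func (V G) (V H)
    s-comm : ∀ e → _≈ᵥ_ H (src H (Func.to f e)) (Func.to g (src G e))
    t-comm : ∀ e → _≈ᵥ_ H (tgt H (Func.to f e)) (Func.to g (tgt G e))
  edge : Edge G → Edge H
  edge = Func.to f
  node : Node G → Node H
  node = Func.to g

open Mor

infix 4 _≈ₘ_
_≈ₘ_ : ∀ {G H} → Mor G H → Mor G H → Set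
_≈ₘ_ {G} {H} m n = (∀ e → _≈ₑ_ H (edge m e) (edge n e)) × (∀ v → _≈ᵥ_ H (node m v) (node n v))

idM : ∀ G → Mor G G
idM G = record
  { f = record { to = id ; cong = id }
  ; g = record { to = id ; cong = id }
  ; s-comm = λ e → Setoid.refl (V G)
  ; t-comm = λ e → Setoid.refl (V G) }

infixr 9 _∘M_
_∘M_ : ∀ {G H K} → Mor H K → Mor G H → Mor G K
_∘M_ {G} {H} {K} m n = record
  { f = record { to = λ e → edge m (edge n e) ; cong = λ p → Func.cong (f m) (Func.cong (f n) p) }
  ; g = record { to = λ v → node m (node n v) ; cong = λ p → Func.cong (g m) (Func.cong (g n) p) }
  ; s-comm = λ e → Setoid.trans (V K) (s-comm m (edge n e)) (Func.cong (g m) (s-comm n e))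
  ; t-comm = λ e → Setoid.trans (V K) (t-comm m (edge n e)) (Func.cong (g m) (t-comm n e)) }

record SGraph : Set₁ where
  field
    graph : Graph
    simple : IsSimple graph

open SGraph

-- inclusion functor I : SGraph → Graph (identity on morphisms)
I : SGraph → Graph
I = graph

SMor : SGraph → SGraph → Set
SMor G H = Mor (I G) (I H)

record LeftAdjointToInclusion : Set₁ where
  field
    L₀ : Graph → SGraph
    L₁ : ∀ {G G'} → Mor G G' → SMor (L₀ G) (L₀ G')
    L₁-resp : ∀ {G G'} {u v : Mor G G'} → u ≈ₘ v → L₁ u ≈ₘ L₁ v
    L₁-id : ∀ {G} → L₁ (idM G) ≈ₘ idM (I (L₀ G))
    L₁-∘ : ∀ {G G' G''} (u : Mor G' G'') (v : Mor G G') → L₁ (u ∘M v) ≈ₘ L₁ u ∘M L₁ v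
    φ : ∀ G (H : SGraph) → SMor (L₀ G) H → Mor G (I H)
    ψ : ∀ G (H : SGraph) → Mor G (I H) → SMor (L₀ G) H
    φ-resp : ∀ {G} {H : SGraph} {k k' : SMor (L₀ G) H} → k ≈ₘ k' → φ G H k ≈ₘ φ G H k'
    ψ-resp : ∀ {G} {H : SGraph} {k k' : Mor G (I H)} → k ≈ₘ k' → ψ G H k ≈ₘ ψ G H k'
    φψ : ∀ {G} {H : SGraph} (k : Mor G (I H)) → φ G H (ψ G H k) ≈ₘ k
    ψφ : ∀ {G} {H : SGraph} (k : SMor (L₀ G) H) → ψ G H (φ G H k) ≈ₘ k
    natural : ∀ {G G'} {H H' : SGraph} (u : Mor G' G) (h : SMor H H') (k : SMor (L₀ G) H) →
              φ G' H' (h ∘M k ∘M L₁ u) ≈ₘ h ∘M φ G H k ∘M u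

IsEqualizer : ∀ {G H K : SGraph} → SMor G H → SMor H K → SMor H K → Set₁
IsEqualizer {G} {H} {K} m p q =
  (p ∘M m ≈ₘ q ∘M m) ×
  (∀ (X : SGraph) (x : SMor X H) → p ∘M x ≈ₘ q ∘M x →
     Σ[ u ∈ SMor X G ] ((m ∘M u ≈ₘ x) × (∀ (u' : SMor X G) → m ∘M u' ≈ₘ x → u' ≈ₘ u)))

IsRegularMono : ∀ {G H : SGraph} → SMor G H → Set₁
IsRegularMono {G} {H} m = Σ[ K ∈ SGraph ] Σ[ p ∈ SMor H K ] Σ[ q ∈ SMor H K ] IsEqualizer {G} {H} {K} m p q

NodeInjective : ∀ {G H : Graph} → Mor G H → Set
NodeInjective {G} {H} m = Injective (_≈ᵥ_ G) (_≈ᵥ_ H) (node m)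

EdgeReflecting : ∀ {G H : Graph} → Mor G H → Set
EdgeReflecting {G} {H} m = ∀ (v₁ v₂ : Node G) → Hom H (node m v₁) (node m v₂) → Hom G v₁ v₂

{-# OPTIONS --safe #-}
module Submission where

-- (1) The reflection L keeps the nodes and identifies parallel edges.  A morphism
-- into a simple graph is determined by its node map, so the unit, counit and all the
-- adjunction laws are identities on nodes.
-- (2) Testing an equalizer against the one-node graph and the one-edge graph shows it
-- is injective on nodes and reflects edges.  Conversely such an m is the equalizer of
-- the two inclusions of H into its cokernel pair (two copies of H glued along the
-- image of m): a morphism equalizing them lands in the image of m on nodes, so it
-- factors through m on nodes, and by edge reflection and simplicity of G on edges.

open import Level using (0ℓ)
open import Defs
open import Data.Product using (_×_; _,_; proj₁; proj₂; Σ-syntax)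
open import Data.Sum using (_⊎_; inj₁; inj₂)
open import Data.Unit using (⊤; tt)
open import Data.Empty using (⊥)
open import Data.Bool using (Bool; true; false)
open import Function.Bundles using (_⇔_; Func; mk⇔)
import Function.Construct.Constant as Constant
import Relation.Binary.Reasoning.Setoid as ≈-Reasoning
open import Relation.Binary.Bundles using (Setoid)
open import Relation.Binary.PropositionalEquality as ≡ using (_≡_; refl)
open Graph
open Mor
open SGraph

module V (G : Graph) = Setoid (V G)

homOf : (G : Graph) (e : Edge G) → Hom G (src G e) (tgt G e)
homOf G e = e , V.refl G , V.refl G

Hom-resp : ∀ (G : Graph) {v v' w w'} → _≈ᵥ_ G v v' → _≈ᵥ_ G w w' → Hom G v w → Hom G v' w'
Hom-resp G v≈v' w≈w' (e , se≈v , te≈w) = e , V.trans G se≈v v≈v' , V.trans G te≈w w≈w'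

mapHom : ∀ {G H} (m : Mor G H) {v w} → Hom G v w → Hom H (node m v) (node m w)
mapHom {G} {H} m (e , se≈v , te≈w) =
  edge m e , V.trans H (s-comm m e) (Func.cong (g m) se≈v)
           , V.trans H (t-comm m e) (Func.cong (g m) te≈w)

edge-unique : ∀ (G : SGraph) {e e'} → _≈ᵥ_ (I G) (src (I G) e) (src (I G) e') →
  _≈ᵥ_ (I G) (tgt (I G) e) (tgt (I G) e') → _≈ₑ_ (I G) e e'
edge-unique G {e} {e'} s≈ t≈ =
  simple G _ _ (homOf (I G) e) (e' , V.sym (I G) s≈ , V.sym (I G) t≈)

-- Congruence on edges comes for free from simplicity of the target.
fromHoms : ∀ {G} (H : SGraph) (n : Func (V G) (V (I H))) →
  (∀ e → Hom (I H) (Func.to n (src G e)) (Func.to n (tgt G e))) → Mor G (I H)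
fromHoms {G} H n hom = record
  { f = record
    { to = λ e → proj₁ (hom e)
    ; cong = λ {e} {e'} e≈e' → simple H _ _ (hom e)
        (Hom-resp (I H) (Func.cong n (V.sym G (Func.cong (s G) e≈e')))
                    (Func.cong n (V.sym G (Func.cong (t G) e≈e'))) (hom e')) }
  ; g = n
  ; s-comm = λ e → proj₁ (proj₂ (hom e))
  ; t-comm = λ e → proj₂ (proj₂ (hom e)) }

≈ₘ-byNodes : ∀ {G} (H : SGraph) (m n : Mor G (I H)) →
  (∀ v → _≈ᵥ_ (I H) (node m v) (node n v)) → m ≈ₘ n
≈ₘ-byNodes {G} H m n m≈n =
  (λ e → edge-unique H
           (V.trans (I H) (s-comm m e) (V.trans (I H) (m≈n (src G e)) (V.sym (I H) (s-comm n e))))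
           (V.trans (I H) (t-comm m e) (V.trans (I H) (m≈n (tgt G e)) (V.sym (I H) (t-comm n e)))))
  , m≈n

Mor-setoid : Graph → Graph → Setoid 0ℓ 0ℓ
Mor-setoid G H = record
  { Carrier = Mor G H
  ; _≈_ = _≈ₘ_
  ; isEquivalence = record
    { refl = (λ _ → Setoid.refl (E H)) , (λ _ → V.refl H)
    ; sym = λ (e≈ , v≈) → (λ e → Setoid.sym (E H) (e≈ e)) , (λ v → V.sym H (v≈ v))
    ; trans = λ (e≈ , v≈) (e≈' , v≈') →
        (λ e → Setoid.trans (E H) (e≈ e) (e≈' e)) , (λ v → V.trans H (v≈ v) (v≈' v)) } }

endpointSGraph : (S : Setoid 0ℓ 0ℓ) (A : Set) (s t : A → Setoid.Carrier S) → SGraph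
endpointSGraph S A s t = record
  { graph = record
    { E = record
      { Carrier = A
      ; _≈_ = λ a b → Setoid._≈_ S (s a) (s b) × Setoid._≈_ S (t a) (t b)
      ; isEquivalence = record
        { refl = Setoid.refl S , Setoid.refl S
        ; sym = λ (p , q) → Setoid.sym S p , Setoid.sym S q
        ; trans = λ (p , q) (p' , q') → Setoid.trans S p p' , Setoid.trans S q q' } }
    ; V = S
    ; s = record { to = s ; cong = proj₁ }
    ; t = record { to = t ; cong = proj₂ } }
  ; simple = λ _ _ (_ , p , q) (_ , p' , q') →
      Setoid.trans S p (Setoid.sym S p') , Setoid.trans S q (Setoid.sym S q') }

reflect : Graph → SGraph
reflect G = endpointSGraph (V G) (Edge G) (src G) (tgt G)

leftAdjoint : LeftAdjointToInclusion
leftAdjoint = record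
  { L₀ = reflect
  ; L₁ = L₁
  ; L₁-resp = λ {_} {G'} {u} {v} (_ , u≈v) → ≈ₘ-byNodes (reflect G') (L₁ u) (L₁ v) u≈v
  ; L₁-id = λ {G} → ≈ₘ-byNodes (reflect G) (L₁ (idM G)) (idM _) (λ _ → V.refl G)
  ; L₁-∘ = λ {_} {_} {G''} u v →
      ≈ₘ-byNodes (reflect G'') (L₁ (u ∘M v)) (L₁ u ∘M L₁ v) (λ _ → V.refl G'')
  ; φ = φ
  ; ψ = ψ
  ; φ-resp = λ {G} {H} {k} {k'} (_ , k≈k') → ≈ₘ-byNodes H (φ G H k) (φ G H k') k≈k'
  ; ψ-resp = λ {G} {H} {k} {k'} (_ , k≈k') → ≈ₘ-byNodes H (ψ G H k) (ψ G H k') k≈k'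
  ; φψ = λ {G} {H} k → ≈ₘ-byNodes H (φ G H (ψ G H k)) k (λ _ → V.refl (I H))
  ; ψφ = λ {G} {H} k → ≈ₘ-byNodes H (ψ G H (φ G H k)) k (λ _ → V.refl (I H))
  ; natural = λ {G} {G'} {H} {H'} u h k →
      ≈ₘ-byNodes H' (φ G' H' (h ∘M k ∘M L₁ u)) (h ∘M φ G H k ∘M u) (λ _ → V.refl (I H'))
  }
  where
  L₁ : ∀ {G G'} → Mor G G' → SMor (reflect G) (reflect G')
  L₁ {G} {G'} u = fromHoms (reflect G') (g u) (λ e → mapHom u (homOf G e))

  φ : ∀ G (H : SGraph) → SMor (reflect G) H → Mor G (I H)
  φ G H k = fromHoms H (g k) (λ e → mapHom k (homOf (I (reflect G)) e))

  ψ : ∀ G (H : SGraph) → Mor G (I H) → SMor (reflect G) H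
  ψ G H k = fromHoms H (g k) (λ e → mapHom k (homOf G e))

pointGraph : SGraph
pointGraph = record
  { graph = record
    { E = ≡.setoid ⊥ ; V = ≡.setoid ⊤
    ; s = record { to = λ () ; cong = λ { {()} } }
    ; t = record { to = λ () ; cong = λ { {()} } } }
  ; simple = λ { _ _ (() , _) } }

pointAt : (H : SGraph) → Node (I H) → SMor pointGraph H
pointAt H v = fromHoms H (Constant.function _ _ v) (λ ())

arrowGraph : SGraph
arrowGraph = record
  { graph = record
    { E = ≡.setoid ⊤ ; V = ≡.setoid Bool
    ; s = Constant.function _ _ true
    ; t = Constant.function _ _ false }
  ; simple = λ _ _ _ _ → refl }

arrowAt : (H : SGraph) {a b : Node (I H)} → Hom (I H) a b → SMor arrowGraph H
arrowAt H {a} {b} h = fromHoms H endpoints (λ _ → h)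
  where
  endpoints : Func (≡.setoid Bool) (V (I H))
  endpoints = record
    { to = λ { true → a ; false → b }
    ; cong = λ { refl → V.refl (I H) } }

∘M-congʳ : ∀ {G H K} {m n : Mor H K} → m ≈ₘ n → (u : Mor G H) → m ∘M u ≈ₘ n ∘M u
∘M-congʳ (e≈ , v≈) u = (λ e → e≈ (edge u e)) , (λ v → v≈ (node u v))

equalizer⇒mono : ∀ {G H K : SGraph} {m : SMor G H} {p q : SMor H K} →
  IsEqualizer {G} {H} {K} m p q →
  ∀ {X : SGraph} (u u' : SMor X G) → m ∘M u ≈ₘ m ∘M u' → u ≈ₘ u'
equalizer⇒mono {G} {H} {K} {m} {p} {q} (pm≈qm , factor) {X} u u' mu≈mu' =
  let (w , _ , unique) = factor X (m ∘M u') (∘M-congʳ {m = p ∘M m} {q ∘M m} pm≈qm u')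
  in begin
       u   ≈⟨ unique u mu≈mu' ⟩
       w   ≈⟨ unique u' (Setoid.refl (Mor-setoid (I X) (I H)) {m ∘M u'}) ⟨
       u'  ∎
  where open ≈-Reasoning (Mor-setoid (I X) (I G))

regularMono⇒nodeInjective : ∀ {G H : SGraph} (m : SMor G H) →
  IsRegularMono {G} {H} m → NodeInjective m
regularMono⇒nodeInjective {G} {H} m (K , p , q , equalizer) {v₁} {v₂} mv₁≈mv₂ =
  proj₂ (equalizer⇒mono {G} {H} {K} {m} {p} {q} equalizer {pointGraph}
          (pointAt G v₁) (pointAt G v₂)
          (≈ₘ-byNodes H (m ∘M pointAt G v₁) (m ∘M pointAt G v₂) (λ _ → mv₁≈mv₂)))
        tt

regularMono⇒edgeReflecting : ∀ {G H : SGraph} (m : SMor G H) →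
  IsRegularMono {G} {H} m → EdgeReflecting m
regularMono⇒edgeReflecting {G} {H} m regular@(K , p , q , pm≈qm , factor) v₁ v₂ h =
  let (u , (_ , mu≈h) , _) = factor arrowGraph (arrowAt H h) p∘h≈q∘h
  in Hom-resp (I G) (injective {node u true} (mu≈h true))
                    (injective {node u false} (mu≈h false))
                    (mapHom u (homOf (I arrowGraph) tt))
  where
  injective : NodeInjective m
  injective {v} {w} = regularMono⇒nodeInjective {G} {H} m regular {v} {w}

  p∘h≈q∘h : p ∘M arrowAt H h ≈ₘ q ∘M arrowAt H h
  p∘h≈q∘h = ≈ₘ-byNodes K (p ∘M arrowAt H h) (q ∘M arrowAt H h)
              (λ { true → proj₂ pm≈qm v₁ ; false → proj₂ pm≈qm v₂ })

module CokernelPair {G H : SGraph} (m : SMor G H) where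

  InImage : Node (I H) → Set
  InImage v = Σ[ w ∈ Node (I G) ] _≈ᵥ_ (I H) (node m w) v

  -- The nodes of the pushout of m with itself.
  gluedNodes : Setoid 0ℓ 0ℓ
  gluedNodes = record
    { Carrier = Node (I H) × Bool
    ; _≈_ = λ (v , b) (w , c) → _≈ᵥ_ (I H) v w × (b ≡ c ⊎ InImage v)
    ; isEquivalence = record
      { refl = V.refl (I H) , inj₁ refl
      ; sym = λ { (v≈w , inj₁ b≡c) → V.sym (I H) v≈w , inj₁ (≡.sym b≡c)
                ; (v≈w , inj₂ (u , mu≈v)) → V.sym (I H) v≈w , inj₂ (u , V.trans (I H) mu≈v v≈w) }
      ; trans = λ { (v≈w , inj₁ b≡c) (w≈x , inj₁ c≡d) →
                      V.trans (I H) v≈w w≈x , inj₁ (≡.trans b≡c c≡d)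
                  ; (v≈w , inj₁ _) (w≈x , inj₂ (u , mu≈w)) →
                      V.trans (I H) v≈w w≈x , inj₂ (u , V.trans (I H) mu≈w (V.sym (I H) v≈w))
                  ; (v≈w , inj₂ v∈im) (w≈x , _) → V.trans (I H) v≈w w≈x , inj₂ v∈im } } }

  K : SGraph
  K = endpointSGraph gluedNodes (Edge (I H) × Bool)
        (λ (e , b) → src (I H) e , b) (λ (e , b) → tgt (I H) e , b)

  inc : Bool → SMor H K
  inc b = fromHoms K (record { to = λ v → v , b ; cong = λ v≈w → v≈w , inj₁ refl })
                     (λ e → homOf (I K) (e , b))

  glued⇒InImage : ∀ {v} → Setoid._≈_ gluedNodes (v , false) (v , true) → InImage v
  glued⇒InImage (_ , inj₂ v∈im) = v∈im

  isEqualizer : NodeInjective m → EdgeReflecting m →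
    IsEqualizer {G} {H} {K} m (inc false) (inc true)
  isEqualizer injective reflecting = inc∘m-agree , factor
    where
    inc∘m-agree : inc false ∘M m ≈ₘ inc true ∘M m
    inc∘m-agree = ≈ₘ-byNodes K (inc false ∘M m) (inc true ∘M m)
                    (λ v → V.refl (I H) , inj₂ (v , V.refl (I H)))

    factor : ∀ (X : SGraph) (x : SMor X H) → inc false ∘M x ≈ₘ inc true ∘M x →
      Σ[ u ∈ SMor X G ] ((m ∘M u ≈ₘ x) × (∀ (u' : SMor X G) → m ∘M u' ≈ₘ x → u' ≈ₘ u))
    factor X x (_ , x-agrees) = u , m∘u≈x , unique
      where
      preimage : ∀ v → InImage (node x v)
      preimage v = glued⇒InImage (x-agrees v)

      nodeMap : Func (V (I X)) (V (I G))
      nodeMap = record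
        { to = λ v → proj₁ (preimage v)
        ; cong = λ {v} {w} v≈w → injective (V.trans (I H) (proj₂ (preimage v))
                   (V.trans (I H) (Func.cong (g x) v≈w) (V.sym (I H) (proj₂ (preimage w))))) }

      u : SMor X G
      u = fromHoms G nodeMap λ e →
            reflecting _ _ (Hom-resp (I H) (V.sym (I H) (proj₂ (preimage (src (I X) e))))
                                           (V.sym (I H) (proj₂ (preimage (tgt (I X) e))))
                                           (mapHom x (homOf (I X) e)))

      m∘u≈x : m ∘M u ≈ₘ x
      m∘u≈x = ≈ₘ-byNodes H (m ∘M u) x (λ v → proj₂ (preimage v))

      unique : ∀ (u' : SMor X G) → m ∘M u' ≈ₘ x → u' ≈ₘ u
      unique u' (_ , m∘u'≈x) = ≈ₘ-byNodes G u' u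
        (λ v → injective (V.trans (I H) (m∘u'≈x v) (V.sym (I H) (proj₂ (preimage v)))))

  isRegularMono : NodeInjective m × EdgeReflecting m → IsRegularMono {G} {H} m
  isRegularMono (injective , reflecting) =
    K , inc false , inc true , isEqualizer injective reflecting

proposition3p7 : LeftAdjointToInclusion
    × (∀ {G H : SGraph} (m : SMor G H) →
         IsRegularMono {G} {H} m ⇔ (NodeInjective m × EdgeReflecting m))
proposition3p7 = leftAdjoint , λ {G} {H} m → mk⇔
  (λ regular → (λ {v} {w} → regularMono⇒nodeInjective {G} {H} m regular {v} {w})
             , regularMono⇒edgeReflecting {G} {H} m regular)
  (CokernelPair.isRegularMono {G} {H} m)
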